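{- Let $D$ be a $\mathcal V$-dcpo with a small basis $\beta:B\to D$, and let $b\ll_\beta c$ mean $\beta(b)\ll\beta(c)$. Then the map $D\to\mathrm{Idl}_{\mathcal V}(B,\ll_\beta)$ sending $x$ to the subset $\{b\in B\mid \beta(b)\ll x\}$ is an isomorphism of $\mathcal V$-dcpos (a Scott continuous map with a Scott continuous inverse).
   Context: Setting: intensional Martin-Löf type theory with universes, function extensionality, propositional extensionality and propositional truncations. A $\mathcal V$-dcpo is a poset (proposition-valued reflexive transitive antisymmetric order) in which every directed family (inhabited index, any two indices have an upper bound index, truncated existence) indexed by a type in $\mathcal V$ has a supremum; Scott continuous maps preserve them. $x\ll y$ if for every directed $\alpha:I\to D$ with $I:\mathcal V$ and $y\sqsubseteq\bigsqcup\alpha$ there exists $i$ with $x\sqsubseteq\alpha_i$. A small basis is $\beta:B\to D$ with $B:\mathcal V$ such that each $\beta(b)\ll x$ is $\mathcal V$-small and for each $x$ the family $\Sigma_{b:B}(\beta(b)\ll x)\to D$ is directed with supremum $x$; in particular $\ll_\beta$ may be taken $\mathcal V$-valued. An abstract $\mathcal V$-basis is $B:\mathcal V$ with a proposition-valued transitive $\prec:B\to B\to\mathcal V$ such that every $a$ has some $b\prec a$ and whenever $a_1,a_2\prec b$ there is $a$ with $a_1,a_2\prec a\prec b$; $(B,\ll_\beta)$ is one. An ideal is a subset $I:B\to\Omega_{\mathcal V}$ that is inhabited, a lower set ($b\in I$, $a\prec b$ imply $a\in I$) and semidirected (for $b_1,b_2\in I$ there exists $b\in I$ with $b_1,b_2\prec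 b$). $\mathrm{Idl}_{\mathcal V}(B,\prec)$ is the type of ideals ordered by inclusion; it is a $\mathcal V$-dcpo with directed suprema given by unions. -}

module Defs where

open import Level using (Level; _⊔_; Setω) renaming (suc to lsuc)
open import Data.Product using (Σ; Σ-syntax; _×_; _,_; proj₁; proj₂)
open import Relation.Binary.PropositionalEquality using (_≡_)
open import Function using (_∘_)

is-prop : ∀ {ℓ} → Set ℓ → Set ℓ
is-prop X = (x y : X) → x ≡ y

is-equiv : ∀ {ℓ ℓ'} {X : Set ℓ} {Y : Set ℓ'} → (X → Y) → Set (ℓ ⊔ ℓ')
is-equiv {X = X} {Y} f =
  (Σ[ s ∈ (Y → X) ] (∀ y → f (s y) ≡ y)) × (Σ[ r ∈ (Y → X) ] (∀ x → r (f x) ≡ x))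

_≃_ : ∀ {ℓ ℓ'} → Set ℓ → Set ℓ' → Set (ℓ ⊔ ℓ')
X ≃ Y = Σ[ f ∈ (X → Y) ] is-equiv f

is-small : ∀ (𝓥 : Level) {ℓ} → Set ℓ → Set (lsuc 𝓥 ⊔ ℓ)
is-small 𝓥 X = Σ[ Y ∈ Set 𝓥 ] (Y ≃ X)

FunExt : Setω
FunExt = ∀ {ℓ ℓ'} {A : Set ℓ} {B : A → Set ℓ'} {f g : (x : A) → B x}
       → (∀ x → f x ≡ g x) → f ≡ g

PropExt : Setω
PropExt = ∀ {ℓ} {P Q : Set ℓ} → is-prop P → is-prop Q → (P → Q) → (Q → P) → P ≡ Q

record PropTrunc : Setω where
  field
    ∥_∥ : ∀ {ℓ} → Set ℓ → Set ℓ
    ∥∥-is-prop : ∀ {ℓ} {X : Set ℓ} → is-prop ∥ X ∥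
    ∣_∣ : ∀ {ℓ} {X : Set ℓ} → X → ∥ X ∥
    ∥∥-rec : ∀ {ℓ ℓ'} {X : Set ℓ} {P : Set ℓ'} → is-prop P → (X → P) → ∥ X ∥ → P

Ω : (𝓥 : Level) → Set (lsuc 𝓥)
Ω 𝓥 = Σ[ P ∈ Set 𝓥 ] is-prop P

module WithPT (pt : PropTrunc) where
  open PropTrunc pt public

  ∃ₜ : ∀ {ℓ ℓ'} {X : Set ℓ} → (X → Set ℓ') → Set (ℓ ⊔ ℓ')
  ∃ₜ {X = X} P = ∥ Σ X P ∥

  module _ {𝓤 𝓣} {D : Set 𝓤} (_⊑_ : D → D → Set 𝓣) where

    is-semidirected : ∀ {𝓘} {I : Set 𝓘} → (I → D) → Set (𝓘 ⊔ 𝓣)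
    is-semidirected {I = I} α = ∀ (i j : I) → ∃ₜ (λ k → (α i ⊑ α k) × (α j ⊑ α k))

    is-directed : ∀ {𝓘} {I : Set 𝓘} → (I → D) → Set (𝓘 ⊔ 𝓣)
    is-directed {I = I} α = ∥ I ∥ × is-semidirected α

    is-upperbound : ∀ {𝓘} {I : Set 𝓘} → (I → D) → D → Set (𝓘 ⊔ 𝓣)
    is-upperbound α u = ∀ i → α i ⊑ u

    is-sup : ∀ {𝓘} {I : Set 𝓘} → (I → D) → D → Set (𝓤 ⊔ 𝓘 ⊔ 𝓣)
    is-sup α s = is-upperbound α s × (∀ u → is-upperbound α u → s ⊑ u)

  is-scott-continuous : (𝓥 : Level) {𝓤 𝓣 𝓤' 𝓣' : Level}
    {X : Set 𝓤} (_⊑_ : X → X → Set 𝓣) {Y : Set 𝓤'} (_⊑'_ : Y → Y → Set 𝓣')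
    → (X → Y) → Set (lsuc 𝓥 ⊔ 𝓤 ⊔ 𝓣 ⊔ 𝓤' ⊔ 𝓣')
  is-scott-continuous 𝓥 _⊑_ _⊑'_ f =
    ∀ {I : Set 𝓥} (α : I → _) → is-directed _⊑_ α
      → ∀ s → is-sup _⊑_ α s → is-sup _⊑'_ (f ∘ α) (f s)

  record DCPO (𝓥 𝓤 𝓣 : Level) : Set (lsuc (𝓥 ⊔ 𝓤 ⊔ 𝓣)) where
    field
      ⟨_⟩ : Set 𝓤
      _⊑_ : ⟨_⟩ → ⟨_⟩ → Set 𝓣
      ⊑-prop : ∀ x y → is-prop (x ⊑ y)
      ⊑-refl : ∀ x → x ⊑ x
      ⊑-trans : ∀ x y z → x ⊑ y → y ⊑ z → x ⊑ z
      ⊑-antisym : ∀ x y → x ⊑ y → y ⊑ x → x ≡ y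
      ∐ : ∀ {I : Set 𝓥} (α : I → ⟨_⟩) → is-directed _⊑_ α → ⟨_⟩
      ∐-is-sup : ∀ {I : Set 𝓥} (α : I → ⟨_⟩) (δ : is-directed _⊑_ α) → is-sup _⊑_ α (∐ α δ)

    _≪_ : ⟨_⟩ → ⟨_⟩ → Set (lsuc 𝓥 ⊔ 𝓤 ⊔ 𝓣)
    x ≪ y = ∀ {I : Set 𝓥} (α : I → ⟨_⟩) (δ : is-directed _⊑_ α)
          → y ⊑ ∐ α δ → ∃ₜ (λ i → x ⊑ α i)

  open DCPO public

  record is-small-basis {𝓥 𝓤 𝓣} (D : DCPO 𝓥 𝓤 𝓣) {B : Set 𝓥} (β : B → ⟨ D ⟩)
    : Set (lsuc 𝓥 ⊔ 𝓤 ⊔ 𝓣) where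
    field
      ≪ᴮ-is-small : ∀ x b → is-small 𝓥 (_≪_ D (β b) x)
      ↡ᴮ-is-directed : ∀ x → is-directed (_⊑_ D) {I = Σ[ b ∈ B ] _≪_ D (β b) x} (β ∘ proj₁)
      ↡ᴮ-is-sup : ∀ x → is-sup (_⊑_ D) {I = Σ[ b ∈ B ] _≪_ D (β b) x} (β ∘ proj₁) x

    -- the 𝓥-valued version of  b ≪_β c  (i.e. β b ≪ β c)
    _≪ᴮₛ_ : B → B → Set 𝓥
    b ≪ᴮₛ c = proj₁ (≪ᴮ-is-small (β c) b)

  module _ {𝓥 𝓦} {B : Set 𝓥} (_≺_ : B → B → Set 𝓦) where

    _∈ₛ_ : B → (B → Ω 𝓥) → Set 𝓥
    b ∈ₛ S = proj₁ (S b)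

    is-ideal : (B → Ω 𝓥) → Set (𝓥 ⊔ 𝓦)
    is-ideal I =
        ∥ Σ[ b ∈ B ] b ∈ₛ I ∥
      × (∀ a b → b ∈ₛ I → a ≺ b → a ∈ₛ I)
      × (∀ b₁ b₂ → b₁ ∈ₛ I → b₂ ∈ₛ I
           → ∃ₜ (λ b → (b ∈ₛ I) × (b₁ ≺ b) × (b₂ ≺ b)))

    Idl : Set (lsuc 𝓥 ⊔ 𝓦)
    Idl = Σ[ I ∈ (B → Ω 𝓥) ] is-ideal I

  _∈ᵢ_ : ∀ {𝓥 𝓦} {B : Set 𝓥} {_≺_ : B → B → Set 𝓦} → B → Idl _≺_ → Set 𝓥
  b ∈ᵢ I = proj₁ (proj₁ I b)

  _⊆ᵢ_ : ∀ {𝓥 𝓦} {B : Set 𝓥} {_≺_ : B → B → Set 𝓦} → Idl _≺_ → Idl _≺_ → Set 𝓥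
  I ⊆ᵢ J = ∀ b → b ∈ᵢ I → b ∈ᵢ J

-- Every x is the directed join of the basis elements way below it, and interpolation for ≪
-- (obtained by approximating each approximant of x once more by the basis) makes
-- ↡ᴮ x = {b ∣ β b ≪ x} rounded, hence an ideal. An ideal I goes back to the join of β
-- over I; since ideals are rounded, b ∈ I exactly when β b ≪ β c for some c ∈ I,
-- which is exactly when β b ≪ ∐ β[I]. Both maps preserve directed joins, the union
-- being the join of a directed family of ideals.
module Submission where

open import Defs
open import Level using (Level)
open import Data.Product using (Σ; Σ-syntax; _×_; _,_; proj₁; proj₂)
open import Data.Product.Properties using (Σ-≡,≡→≡)
open import Data.Unit.Polymorphic using (⊤; tt)
open import Relation.Binary.PropositionalEquality using (_≡_; sym; trans; cong; cong₂)
open import Axiom.UniquenessOfIdentityProofs.WithK using (uip)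

Σ-≡-prop : ∀ {a b} {A : Set a} {P : A → Set b} → (∀ x → is-prop (P x))
  → {u v : Σ A P} → proj₁ u ≡ proj₁ v → u ≡ v
Σ-≡-prop P-is-prop p = Σ-≡,≡→≡ (p , P-is-prop _ _ _)

is-prop-is-prop : FunExt → ∀ {ℓ} {P : Set ℓ} → is-prop (is-prop P)
is-prop-is-prop fe p q = fe λ x → fe λ y → uip (p x y) (q x y)

×-is-prop : ∀ {a b} {P : Set a} {Q : Set b} → is-prop P → is-prop Q → is-prop (P × Q)
×-is-prop P-is-prop Q-is-prop (p , q) (p' , q') = cong₂ _,_ (P-is-prop p p') (Q-is-prop q q')

≃-reflects-is-prop : ∀ {ℓ ℓ'} {X : Set ℓ} {Y : Set ℓ'} → X ≃ Y → is-prop Y → is-prop X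
≃-reflects-is-prop (f , _ , (r , rf)) Y-is-prop x x' =
  trans (sym (rf x)) (trans (cong r (Y-is-prop (f x) (f x'))) (rf x'))

module _ (pt : PropTrunc) where
  open WithPT pt

  _>>=_ : ∀ {a b} {A : Set a} {C : Set b} → ∥ A ∥ → (A → ∥ C ∥) → ∥ C ∥
  m >>= k = ∥∥-rec ∥∥-is-prop k m

  ∥∥-map : ∀ {a b} {A : Set a} {C : Set b} → (A → C) → ∥ A ∥ → ∥ C ∥
  ∥∥-map f = ∥∥-rec ∥∥-is-prop (λ a → ∣ f a ∣)

  module WayBelow {𝓥 𝓤 𝓣 : Level} (D : DCPO 𝓥 𝓤 𝓣) where

    private
      _⊑ᴰ_ = _⊑_ D
      _≪ᴰ_ = _≪_ D

    ⊑ᴰ-trans : ∀ {x y z} → x ⊑ᴰ y → y ⊑ᴰ z → x ⊑ᴰ z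
    ⊑ᴰ-trans = ⊑-trans D _ _ _

    ∐-is-upperbound : ∀ {I : Set 𝓥} (α : I → ⟨ D ⟩) (δ : is-directed _⊑ᴰ_ α)
      → is-upperbound _⊑ᴰ_ α (∐ D α δ)
    ∐-is-upperbound α δ = proj₁ (∐-is-sup D α δ)

    ∐-is-lowerbound-of-upperbounds : ∀ {I : Set 𝓥} (α : I → ⟨ D ⟩) (δ : is-directed _⊑ᴰ_ α)
      → ∀ u → is-upperbound _⊑ᴰ_ α u → ∐ D α δ ⊑ᴰ u
    ∐-is-lowerbound-of-upperbounds α δ = proj₂ (∐-is-sup D α δ)

    ≪-is-prop : FunExt → ∀ x y → is-prop (x ≪ᴰ y)
    ≪-is-prop fe x y p q =
      cong (λ h {I} → h I) (fe λ I → fe λ α → fe λ δ → fe λ _ → ∥∥-is-prop _ _)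

    ≪-below-sup : ∀ {x y s} {I : Set 𝓥} {α : I → ⟨ D ⟩} → is-directed _⊑ᴰ_ α → is-sup _⊑ᴰ_ α s
      → x ≪ᴰ y → y ⊑ᴰ s → ∃ₜ (λ i → x ⊑ᴰ α i)
    ≪-below-sup {α = α} δ s-is-sup x≪y y⊑s =
      x≪y α δ (⊑ᴰ-trans y⊑s (proj₂ s-is-sup (∐ D α δ) (∐-is-upperbound α δ)))

    -- Test x ≪ y against the constant family at y.
    ≪⇒⊑ : ∀ {x y} → x ≪ᴰ y → x ⊑ᴰ y
    ≪⇒⊑ {x} {y} x≪y = ∥∥-rec (⊑-prop D x y) proj₂
      (x≪y const-y const-y-is-directed (∐-is-upperbound const-y const-y-is-directed tt))
      where
        const-y : ⊤ {𝓥} → ⟨ D ⟩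
        const-y _ = y
        const-y-is-directed : is-directed _⊑ᴰ_ const-y
        const-y-is-directed = ∣ tt ∣ , λ _ _ → ∣ tt , ⊑-refl D y , ⊑-refl D y ∣

    ⊑-≪-trans : ∀ {x y z} → x ⊑ᴰ y → y ≪ᴰ z → x ≪ᴰ z
    ⊑-≪-trans x⊑y y≪z α δ z⊑∐ =
      ∥∥-map (λ (i , y⊑αi) → i , ⊑ᴰ-trans x⊑y y⊑αi) (y≪z α δ z⊑∐)

    ≪-⊑-trans : ∀ {x y z} → x ≪ᴰ y → y ⊑ᴰ z → x ≪ᴰ z
    ≪-⊑-trans x≪y y⊑z α δ z⊑∐ = x≪y α δ (⊑ᴰ-trans y⊑z z⊑∐)

    ≪-trans : ∀ {x y z} → x ≪ᴰ y → y ≪ᴰ z → x ≪ᴰ z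
    ≪-trans x≪y y≪z = ≪-⊑-trans x≪y (≪⇒⊑ y≪z)

  module SmallBasis {𝓥 𝓤 𝓣 : Level} (D : DCPO 𝓥 𝓤 𝓣) {B : Set 𝓥} (β : B → ⟨ D ⟩)
    (sb : is-small-basis D β) where
    open is-small-basis sb
    open WayBelow D

    private
      _⊑ᴰ_ = _⊑_ D
      _≪ᴰ_ = _≪_ D

    -- b ≪ᴮₛ c is definitionally b ≪ₛ β c.
    _≪ₛ_ : B → ⟨ D ⟩ → Set 𝓥
    b ≪ₛ x = proj₁ (≪ᴮ-is-small x b)

    ≪ₛ⇒≪ : ∀ {b x} → b ≪ₛ x → β b ≪ᴰ x
    ≪ₛ⇒≪ {b} {x} = proj₁ (proj₂ (≪ᴮ-is-small x b))

    ≪⇒≪ₛ : ∀ {b x} → β b ≪ᴰ x → b ≪ₛ x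
    ≪⇒≪ₛ {b} {x} = proj₁ (proj₁ (proj₂ (proj₂ (≪ᴮ-is-small x b))))

    ≪ₛ-is-prop : FunExt → ∀ {b x} → is-prop (b ≪ₛ x)
    ≪ₛ-is-prop fe {b} {x} = ≃-reflects-is-prop (proj₂ (≪ᴮ-is-small x b)) (≪-is-prop fe _ _)

    ↡ᴮₛ : ⟨ D ⟩ → Set 𝓥
    ↡ᴮₛ x = Σ B (_≪ₛ x)

    ↡ιₛ : (x : ⟨ D ⟩) → ↡ᴮₛ x → ⟨ D ⟩
    ↡ιₛ x (b , _) = β b

    ↡ιₛ-is-directed : ∀ x → is-directed _⊑ᴰ_ (↡ιₛ x)
    ↡ιₛ-is-directed x =
        ∥∥-map (λ (b , b≪x) → b , ≪⇒≪ₛ b≪x) (proj₁ (↡ᴮ-is-directed x))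
      , λ (b₁ , b₁≪x) (b₂ , b₂≪x) →
          ∥∥-map (λ ((b , b≪x) , b₁⊑b , b₂⊑b) → (b , ≪⇒≪ₛ b≪x) , b₁⊑b , b₂⊑b)
          (proj₂ (↡ᴮ-is-directed x) (b₁ , ≪ₛ⇒≪ b₁≪x) (b₂ , ≪ₛ⇒≪ b₂≪x))

    ⊑-from-basis : ∀ x u → (∀ b → b ≪ₛ x → β b ⊑ᴰ u) → x ⊑ᴰ u
    ⊑-from-basis x u below-u = proj₂ (↡ᴮ-is-sup x) u (λ (b , b≪x) → below-u b (≪⇒≪ₛ b≪x))

    ⊑-∐-↡ιₛ : ∀ x → x ⊑ᴰ ∐ D (↡ιₛ x) (↡ιₛ-is-directed x)
    ⊑-∐-↡ιₛ x = ⊑-from-basis x _ λ b b≪x → ∐-is-upperbound (↡ιₛ x) (↡ιₛ-is-directed x) (b , b≪x)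

    ≪-approximated-by-basis : ∀ {y x} → y ≪ᴰ x → ∃ₜ (λ ((b , _) : ↡ᴮₛ x) → y ⊑ᴰ β b)
    ≪-approximated-by-basis {x = x} y≪x = y≪x (↡ιₛ x) (↡ιₛ-is-directed x) (⊑-∐-↡ιₛ x)

    -- x is also the join of the directed family of all β c with c ≪ₛ β b and b ≪ₛ x,
    -- so y ≪ x lies below one such β c, and then y ⊑ β c ≪ β b ≪ x.
    ≪-interpolation : ∀ {y x} → y ≪ᴰ x → ∃ₜ (λ b → (y ≪ᴰ β b) × (β b ≪ᴰ x))
    ≪-interpolation {y} {x} y≪x = ∥∥-map interpolant (y≪x γ γ-is-directed x⊑∐γ)
      where
        J : Set 𝓥
        J = Σ[ b ∈ B ] (b ≪ₛ x × Σ[ c ∈ B ] c ≪ₛ β b)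

        γ : J → ⟨ D ⟩
        γ (_ , _ , c , _) = β c

        γ-is-directed : is-directed _⊑ᴰ_ γ
        γ-is-directed =
            (do (b , b≪x) ← proj₁ (↡ιₛ-is-directed x)
                (c , c≪b) ← proj₁ (↡ιₛ-is-directed (β b))
                ∣ b , b≪x , c , c≪b ∣)
          , λ (b₁ , b₁≪x , c₁ , c₁≪b₁) (b₂ , b₂≪x , c₂ , c₂≪b₂) → do
              ((b , b≪x) , b₁⊑b , b₂⊑b) ← proj₂ (↡ιₛ-is-directed x) (b₁ , b₁≪x) (b₂ , b₂≪x)
              (d₁ , c₁⊑d₁) ← ≪-approximated-by-basis (≪-⊑-trans (≪ₛ⇒≪ c₁≪b₁) b₁⊑b)
              (d₂ , c₂⊑d₂) ← ≪-approximated-by-basis (≪-⊑-trans (≪ₛ⇒≪ c₂≪b₂) b₂⊑b)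
              ((c , c≪b) , d₁⊑c , d₂⊑c) ← proj₂ (↡ιₛ-is-directed (β b)) d₁ d₂
              ∣ (b , b≪x , c , c≪b) , ⊑ᴰ-trans c₁⊑d₁ d₁⊑c , ⊑ᴰ-trans c₂⊑d₂ d₂⊑c ∣

        interpolant : Σ[ j ∈ J ] y ⊑ᴰ γ j → Σ[ b ∈ B ] (y ≪ᴰ β b) × (β b ≪ᴰ x)
        interpolant ((b , b≪x , c , c≪b) , y⊑c) = b , ⊑-≪-trans y⊑c (≪ₛ⇒≪ c≪b) , ≪ₛ⇒≪ b≪x

        x⊑∐γ : x ⊑ᴰ ∐ D γ γ-is-directed
        x⊑∐γ = ⊑-from-basis x _ λ b b≪x → ⊑-from-basis (β b) _ λ c c≪b →
          ∐-is-upperbound γ γ-is-directed (b , b≪x , c , c≪b)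

  module Ideals {𝓥 𝓦 : Level} {B : Set 𝓥} (_≺_ : B → B → Set 𝓦) where

    ∈ᵢ-is-prop : (I : Idl _≺_) → ∀ b → is-prop (b ∈ᵢ I)
    ∈ᵢ-is-prop I b = proj₂ (proj₁ I b)

    ideal-is-inhabited : (I : Idl _≺_) → ∥ Σ[ b ∈ B ] b ∈ᵢ I ∥
    ideal-is-inhabited I = proj₁ (proj₂ I)

    ideal-is-lowerset : (I : Idl _≺_) → ∀ a b → b ∈ᵢ I → a ≺ b → a ∈ᵢ I
    ideal-is-lowerset I = proj₁ (proj₂ (proj₂ I))

    ideal-is-semidirected : (I : Idl _≺_) → ∀ b₁ b₂ → b₁ ∈ᵢ I → b₂ ∈ᵢ I
      → ∃ₜ (λ b → (b ∈ᵢ I) × (b₁ ≺ b) × (b₂ ≺ b))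
    ideal-is-semidirected I = proj₂ (proj₂ (proj₂ I))

    ideal-is-rounded : (I : Idl _≺_) → ∀ b → b ∈ᵢ I → ∃ₜ (λ c → (c ∈ᵢ I) × (b ≺ c))
    ideal-is-rounded I b b∈I =
      ∥∥-map (λ (c , c∈I , b≺c , _) → c , c∈I , b≺c) (ideal-is-semidirected I b b b∈I b∈I)

    is-ideal-is-prop : FunExt → (S : B → Ω 𝓥) → is-prop (is-ideal _≺_ S)
    is-ideal-is-prop fe S = ×-is-prop ∥∥-is-prop (×-is-prop
      (λ _ _ → fe λ a → fe λ b → fe λ _ → fe λ _ → proj₂ (S a) _ _)
      (λ _ _ → fe λ b₁ → fe λ b₂ → fe λ _ → fe λ _ → ∥∥-is-prop _ _))

    Idl-ext : FunExt → PropExt → {I J : Idl _≺_} → I ⊆ᵢ J → J ⊆ᵢ I → I ≡ J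
    Idl-ext fe pe {I} {J} I⊆J J⊆I = Σ-≡-prop (is-ideal-is-prop fe) (fe λ b →
      Σ-≡-prop (λ _ → is-prop-is-prop fe)
        (pe (∈ᵢ-is-prop I b) (∈ᵢ-is-prop J b) (I⊆J b) (J⊆I b)))

    ⋃ᵢ : {A : Set 𝓥} (α : A → Idl _≺_) → is-directed _⊆ᵢ_ α → Idl _≺_
    ⋃ᵢ α δ =
        (λ b → ∃ₜ (λ i → b ∈ᵢ α i) , ∥∥-is-prop)
      , (do i ← proj₁ δ
            (b , b∈αi) ← ideal-is-inhabited (α i)
            ∣ b , ∣ i , b∈αi ∣ ∣)
      , (λ a b b∈⋃ a≺b → ∥∥-map (λ (i , b∈αi) → i , ideal-is-lowerset (α i) a b b∈αi a≺b) b∈⋃)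
      , λ b₁ b₂ b₁∈⋃ b₂∈⋃ → do
          (i , b₁∈αi) ← b₁∈⋃
          (j , b₂∈αj) ← b₂∈⋃
          (k , αi⊆αk , αj⊆αk) ← proj₂ δ i j
          (b , b∈αk , b₁≺b , b₂≺b) ←
            ideal-is-semidirected (α k) b₁ b₂ (αi⊆αk b₁ b₁∈αi) (αj⊆αk b₂ b₂∈αj)
          ∣ b , ∣ k , b∈αk ∣ , b₁≺b , b₂≺b ∣

    ⋃ᵢ-is-upperbound : {A : Set 𝓥} (α : A → Idl _≺_) (δ : is-directed _⊆ᵢ_ α)
      → is-upperbound _⊆ᵢ_ α (⋃ᵢ α δ)
    ⋃ᵢ-is-upperbound α δ i b b∈αi = ∣ i , b∈αi ∣

  module IdealCompletion (fe : FunExt) (pe : PropExt)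
    {𝓥 𝓤 𝓣 : Level} (D : DCPO 𝓥 𝓤 𝓣) {B : Set 𝓥} (β : B → ⟨ D ⟩)
    (sb : is-small-basis D β) where
    open is-small-basis sb
    open WayBelow D
    open SmallBasis D β sb
    open Ideals _≪ᴮₛ_

    private
      _⊑ᴰ_ = _⊑_ D
      _⊆_ = _⊆ᵢ_ {_≺_ = _≪ᴮₛ_}

    ↡ᴮ-ideal : ⟨ D ⟩ → Idl _≪ᴮₛ_
    ↡ᴮ-ideal x =
        (λ b → b ≪ₛ x , ≪ₛ-is-prop fe)
      , proj₁ (↡ιₛ-is-directed x)
      , (λ a b b≪x a≪b → ≪⇒≪ₛ (≪-trans (≪ₛ⇒≪ a≪b) (≪ₛ⇒≪ b≪x)))
      , λ b₁ b₂ b₁≪x b₂≪x → do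
          (c₁ , b₁≪c₁ , c₁≪x) ← ≪-interpolation (≪ₛ⇒≪ b₁≪x)
          (c₂ , b₂≪c₂ , c₂≪x) ← ≪-interpolation (≪ₛ⇒≪ b₂≪x)
          ((b , b≪x) , c₁⊑b , c₂⊑b) ← proj₂ (↡ιₛ-is-directed x) (c₁ , ≪⇒≪ₛ c₁≪x) (c₂ , ≪⇒≪ₛ c₂≪x)
          ∣ b , b≪x , ≪⇒≪ₛ (≪-⊑-trans b₁≪c₁ c₁⊑b) , ≪⇒≪ₛ (≪-⊑-trans b₂≪c₂ c₂⊑b) ∣

    ideal-family : (I : Idl _≪ᴮₛ_) → Σ[ b ∈ B ] b ∈ᵢ I → ⟨ D ⟩
    ideal-family I (b , _) = β b

    ideal-family-is-directed : ∀ I → is-directed _⊑ᴰ_ (ideal-family I)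
    ideal-family-is-directed I =
        ideal-is-inhabited I
      , λ (b₁ , b₁∈I) (b₂ , b₂∈I) →
          ∥∥-map (λ (b , b∈I , b₁≪b , b₂≪b) → (b , b∈I) , ≪⇒⊑ (≪ₛ⇒≪ b₁≪b) , ≪⇒⊑ (≪ₛ⇒≪ b₂≪b))
            (ideal-is-semidirected I b₁ b₂ b₁∈I b₂∈I)

    ∐-ideal : Idl _≪ᴮₛ_ → ⟨ D ⟩
    ∐-ideal I = ∐ D (ideal-family I) (ideal-family-is-directed I)

    ⊑-∐-ideal : ∀ I b → b ∈ᵢ I → β b ⊑ᴰ ∐-ideal I
    ⊑-∐-ideal I b b∈I = ∐-is-upperbound (ideal-family I) (ideal-family-is-directed I) (b , b∈I)

    ∐-ideal-⊑ : ∀ I u → (∀ b → b ∈ᵢ I → β b ⊑ᴰ u) → ∐-ideal I ⊑ᴰ u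
    ∐-ideal-⊑ I u below-u = ∐-is-lowerbound-of-upperbounds (ideal-family I)
      (ideal-family-is-directed I) u (λ (b , b∈I) → below-u b b∈I)

    ∐-ideal-↡ᴮ-ideal : ∀ x → ∐-ideal (↡ᴮ-ideal x) ≡ x
    ∐-ideal-↡ᴮ-ideal x = ⊑-antisym D _ _
      (∐-ideal-⊑ (↡ᴮ-ideal x) x λ _ b≪x → ≪⇒⊑ (≪ₛ⇒≪ b≪x))
      (⊑-from-basis x _ (⊑-∐-ideal (↡ᴮ-ideal x)))

    ↡ᴮ-ideal-∐-ideal : ∀ I → ↡ᴮ-ideal (∐-ideal I) ≡ I
    ↡ᴮ-ideal-∐-ideal I = Idl-ext fe pe ↡∐I⊆I I⊆↡∐I
      where
        ↡∐I⊆I : ↡ᴮ-ideal (∐-ideal I) ⊆ I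
        ↡∐I⊆I b b≪∐I = ∥∥-rec (∈ᵢ-is-prop I b)
          (λ ((c , c∈I) , b⊑c) → ∥∥-rec (∈ᵢ-is-prop I b)
             (λ (c' , c'∈I , c≪c') →
                ideal-is-lowerset I b c' c'∈I (≪⇒≪ₛ (⊑-≪-trans b⊑c (≪ₛ⇒≪ c≪c'))))
             (ideal-is-rounded I c c∈I))
          (≪ₛ⇒≪ b≪∐I (ideal-family I) (ideal-family-is-directed I) (⊑-refl D _))

        I⊆↡∐I : I ⊆ ↡ᴮ-ideal (∐-ideal I)
        I⊆↡∐I b b∈I = ∥∥-rec (≪ₛ-is-prop fe)
          (λ (c , c∈I , b≪c) → ≪⇒≪ₛ (≪-⊑-trans (≪ₛ⇒≪ b≪c) (⊑-∐-ideal I c c∈I)))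
          (ideal-is-rounded I b b∈I)

    ↡ᴮ-ideal-is-continuous : is-scott-continuous 𝓥 _⊑ᴰ_ _⊆_ ↡ᴮ-ideal
    ↡ᴮ-ideal-is-continuous α δ s s-is-sup =
        (λ i b b≪αi → ≪⇒≪ₛ (≪-⊑-trans (≪ₛ⇒≪ b≪αi) (proj₁ s-is-sup i)))
      , λ J ↡α⊆J b b≪s → ∥∥-rec (∈ᵢ-is-prop J b)
          (λ (c , b≪c , c≪s) → ∥∥-rec (∈ᵢ-is-prop J b)
             (λ (i , c⊑αi) → ↡α⊆J i b (≪⇒≪ₛ (≪-⊑-trans b≪c c⊑αi)))
             (≪-below-sup δ s-is-sup c≪s (⊑-refl D s)))
          (≪-interpolation (≪ₛ⇒≪ b≪s))

    ∐-ideal-is-monotone : ∀ I J → I ⊆ J → ∐-ideal I ⊑ᴰ ∐-ideal J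
    ∐-ideal-is-monotone I J I⊆J = ∐-ideal-⊑ I _ λ b b∈I → ⊑-∐-ideal J b (I⊆J b b∈I)

    -- The join S of a directed family of ideals is contained in their union, an upper bound.
    ∐-ideal-is-continuous : is-scott-continuous 𝓥 _⊆_ _⊑ᴰ_ ∐-ideal
    ∐-ideal-is-continuous α δ S S-is-sup =
        (λ i → ∐-ideal-is-monotone (α i) S (proj₁ S-is-sup i))
      , λ u ∐α⊑u → ∐-ideal-⊑ S u λ b b∈S → ∥∥-rec (⊑-prop D _ _)
          (λ (i , b∈αi) → ⊑ᴰ-trans (⊑-∐-ideal (α i) b b∈αi) (∐α⊑u i))
          (proj₂ S-is-sup (⋃ᵢ α δ) (⋃ᵢ-is-upperbound α δ) b b∈S)

mainTheorem15 : FunExt → PropExt → (pt : PropTrunc)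
    → let open WithPT pt in
    ∀ {𝓥 𝓤 𝓣 : Level} (D : DCPO 𝓥 𝓤 𝓣) {B : Set 𝓥} (β : B → ⟨ D ⟩)
    (sb : is-small-basis D β)
    → let open is-small-basis sb in
    Σ[ f ∈ (⟨ D ⟩ → Idl _≪ᴮₛ_) ]
    ((∀ x b → ((b ∈ᵢ f x) → _≪_ D (β b) x) × (_≪_ D (β b) x → (b ∈ᵢ f x)))
    × Σ[ g ∈ (Idl _≪ᴮₛ_ → ⟨ D ⟩) ]
    ((∀ x → g (f x) ≡ x)
    × (∀ I → f (g I) ≡ I)
    × is-scott-continuous 𝓥 (_⊑_ D) (_⊆ᵢ_ {_≺_ = _≪ᴮₛ_}) f
    × is-scott-continuous 𝓥 (_⊆ᵢ_ {_≺_ = _≪ᴮₛ_}) (_⊑_ D) g))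
mainTheorem15 fe pe pt D β sb =
    ↡ᴮ-ideal , (λ x b → ≪ₛ⇒≪ , ≪⇒≪ₛ)
  , ∐-ideal , ∐-ideal-↡ᴮ-ideal , ↡ᴮ-ideal-∐-ideal
  , ↡ᴮ-ideal-is-continuous , ∐-ideal-is-continuous
  where
    open SmallBasis pt D β sb using (≪ₛ⇒≪; ≪⇒≪ₛ)
    open IdealCompletion pt fe pe D β sb
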